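{- Let $m\ge 3$ and $1<c_2<c_3<\cdots<c_m<c_{m+1}$ be natural numbers, and let $\$_1=\langle 1,c_2,c_3\rangle$, $\$_2=\langle 1,c_2,\dots,c_m\rangle$ and $\$_3=\langle 1,c_2,\dots,c_m,c_{m+1}\rangle$ be three tight coin systems such that $\$_1$ is canonical but $\$_2$ is not. If $\$_3$ is non-canonical, then there are indices $2\le i\le j\le m$ such that $x=c_i+c_j$ satisfies $x>c_{m+1}$ and $x$ is a counterexample of $\$_3$.
   Context: A coin system is a tuple $\$=\langle c_1,\dots,c_m\rangle$ of natural numbers with $1=c_1<c_2<\cdots<c_m$. A representation of $x$ is a tuple $(\alpha_1,\dots,\alpha_m)$ of natural numbers with $\sum_i\alpha_ic_i=x$, of size $\sum_i\alpha_i$. The greedy representation $\mathrm{GRD}_{\$}(x)$ is the representation with $\sum_{j<i}\alpha_jc_j<c_i$ for all $2\le i\le m$; $\mathrm{OPT}_{\$}(x)$ is a representation of minimum size. A counterexample of $\$$ is a natural number $x$ with $|\mathrm{GRD}_{\$}(x)|>|\mathrm{OPT}_{\$}(x)|$; $\$$ is canonical if it has no counterexample and non-canonical otherwise. $\$$ is tight if it has no counterexample smaller than its largest coin $c_m$. -}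

module Defs where

open import Data.Nat using (ℕ; zero; suc; _+_; _*_; _∸_; _≤_; _<_)
open import Data.Product using (Σ; _×_; ∃-syntax)
open import Relation.Binary.PropositionalEquality using (_≡_)
open import Relation.Nullary using (¬_)

-- Coins are indexed 1-based as in the paper: a coin system with n coins is
-- given by (n , c) with coins c 1 , … , c n.  Coefficient tuples are
-- α : ℕ → ℕ, of which only α 1 , … , α n matter.

sumTo : (ℕ → ℕ) → ℕ → ℕ
sumTo f zero    = 0
sumTo f (suc k) = sumTo f k + f (suc k)

IsCoinSystem : ℕ → (ℕ → ℕ) → Set
IsCoinSystem n c = (c 1 ≡ 1) × (∀ i → 1 ≤ i → i < n → c i < c (suc i))

value : (ℕ → ℕ) → (ℕ → ℕ) → ℕ → ℕ
value c α k = sumTo (λ j → α j * c j) k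

size : ℕ → (ℕ → ℕ) → ℕ
size n α = sumTo α n

IsRep : ℕ → (ℕ → ℕ) → (ℕ → ℕ) → ℕ → Set
IsRep n c α x = value c α n ≡ x

IsGreedy : ℕ → (ℕ → ℕ) → (ℕ → ℕ) → ℕ → Set
IsGreedy n c α x = IsRep n c α x × (∀ i → 2 ≤ i → i ≤ n → value c α (i ∸ 1) < c i)

-- x is a counterexample: |GRD(x)| > |OPT(x)|, i.e. some representation is
-- strictly smaller than the (unique) greedy representation
Counterexample : ℕ → (ℕ → ℕ) → ℕ → Set
Counterexample n c x =
  Σ (ℕ → ℕ) λ g → Σ (ℕ → ℕ) λ r →
    IsGreedy n c g x × IsRep n c r x × (size n r < size n g)

Canonical : ℕ → (ℕ → ℕ) → Set
Canonical n c = ∀ x → ¬ Counterexample n c x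

NonCanonical : ℕ → (ℕ → ℕ) → Set
NonCanonical n c = ∃[ x ] Counterexample n c x

Tight : ℕ → (ℕ → ℕ) → Set
Tight n c = ∀ x → x < c n → ¬ Counterexample n c x

module Submission where

-- Write d = c (m + 1) and G for the greedy size in ⟨ c 1 , … , c (m + 1) ⟩.  Tightness
-- makes greedy optimal below d; since ⟨ c 1 , … , c m ⟩ is non-canonical this forces
-- d < 2 c m, for greedy optimal below 2 c m would make that system canonical.  Now suppose
-- no c i + c j > d with 2 ≤ i ≤ j ≤ m is a counterexample, i.e. G (c i + c j) ≤ 2.  Then
-- every excess c i + c j − d of two coins below d is 0 or a single coin, and a strong
-- induction on y, splitting on the greedy top coin of y, shows: if y < d, a ≤ m and
-- y + c a = d + r, then G r ≤ G y.  So at every x ≥ d greedy's first coin d is as good as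
-- any other first coin, and greedy is optimal everywhere, contradicting the
-- non-canonicity of the extended system.

open import Defs
open import Data.Nat
open import Data.Nat.Properties
open import Data.Nat.DivMod
open import Data.Nat.Divisibility using (divides)
open import Data.Nat.Induction using (<-rec)
open import Data.Nat.ListAction using (sum)
open import Data.Nat.ListAction.Properties using (sum-++)
open import Data.Product using (_×_; _,_; ∃-syntax; proj₁; proj₂)
open import Data.Sum using (inj₁; inj₂)
open import Data.Empty using (⊥-elim)
open import Data.List using (List; []; _∷_; _++_; length; map; replicate)
open import Data.List.Properties using (length-++; length-replicate; map-++; map-replicate)
open import Data.List.Relation.Unary.All as All using (All; []; _∷_)
open import Data.List.Relation.Unary.All.Properties using (++⁺; replicate⁺)
open import Algebra.Properties.CommutativeSemigroup +-commutativeSemigroup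
  using (interchange; xy∙z≈xz∙y; xy∙z≈zy∙x; xy∙z≈x∙zy; x∙yz≈y∙xz)
open import Relation.Binary.PropositionalEquality
open import Relation.Nullary using (¬_; Dec; yes; no; _×-dec_)

sumTo-cong : ∀ {f g : ℕ → ℕ} k → (∀ {i} → 1 ≤ i → i ≤ k → f i ≡ g i) →
             sumTo f k ≡ sumTo g k
sumTo-cong zero    f≗g = refl
sumTo-cong (suc k) f≗g =
  cong₂ _+_ (sumTo-cong k λ 1≤i i≤k → f≗g 1≤i (m≤n⇒m≤1+n i≤k)) (f≗g (s≤s z≤n) ≤-refl)

sumTo-zero : ∀ k → sumTo (λ _ → 0) k ≡ 0
sumTo-zero zero    = refl
sumTo-zero (suc k) = trans (+-identityʳ _) (sumTo-zero k)

sumTo-+ : ∀ f g k → sumTo (λ i → f i + g i) k ≡ sumTo f k + sumTo g k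
sumTo-+ f g zero    = refl
sumTo-+ f g (suc k) = trans (cong (_+ (f (suc k) + g (suc k))) (sumTo-+ f g k))
                            (interchange (sumTo f k) (sumTo g k) (f (suc k)) (g (suc k)))

δ : ℕ → ℕ → ℕ
δ j i with i ≟ j
... | yes _ = 1
... | no  _ = 0

δ-refl : ∀ j → δ j j ≡ 1
δ-refl j with j ≟ j
... | yes _  = refl
... | no j≢j = ⊥-elim (j≢j refl)

δ-≢ : ∀ {j i} → i ≢ j → δ j i ≡ 0
δ-≢ {j} {i} i≢j with i ≟ j
... | yes i≡j = ⊥-elim (i≢j i≡j)
... | no  _   = refl

sumTo-δ*-< : ∀ (f : ℕ → ℕ) {j} k → k < j → sumTo (λ i → δ j i * f i) k ≡ 0
sumTo-δ*-< f zero    _   = refl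
sumTo-δ*-< f (suc k) k<j =
  cong₂ _+_ (sumTo-δ*-< f k (<-trans (n<1+n k) k<j)) (cong (_* f (suc k)) (δ-≢ (<⇒≢ k<j)))

sumTo-δ* : ∀ (f : ℕ → ℕ) {j} k → 1 ≤ j → j ≤ k → sumTo (λ i → δ j i * f i) k ≡ f j
sumTo-δ* f zero 1≤j j≤0 with () ← ≤-trans 1≤j j≤0
sumTo-δ* f {j} (suc k) 1≤j j≤1+k with j ≟ suc k
... | yes refl = trans (cong₂ _+_ (sumTo-δ*-< f k ≤-refl) (cong (_* f j) (δ-refl j))) (+-identityʳ (f j))
... | no  j≢1+k =
  trans (cong₂ _+_ (sumTo-δ* f k 1≤j (≤-pred (≤∧≢⇒< j≤1+k j≢1+k)))
                   (cong (_* f (suc k)) (δ-≢ (≢-sym j≢1+k))))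
        (+-identityʳ (f j))

sum-replicate : ∀ k v → sum (replicate k v) ≡ k * v
sum-replicate zero    v = refl
sum-replicate (suc k) v = cong (v +_) (sum-replicate k v)

Indices : ℕ → List ℕ → Set
Indices n = All (λ i → 1 ≤ i × i ≤ n)

multiplicity : List ℕ → ℕ → ℕ
multiplicity []      i = 0
multiplicity (j ∷ O) i = δ j i + multiplicity O i

toList : ℕ → (ℕ → ℕ) → List ℕ
toList zero    α = []
toList (suc n) α = toList n α ++ replicate (α (suc n)) (suc n)

module _ (c : ℕ → ℕ) where

  value-multiplicity : ∀ n {O} → Indices n O → value c (multiplicity O) n ≡ sum (map c O)
  value-multiplicity n {[]}    []              =
    trans (sumTo-cong n λ _ _ → refl) (sumTo-zero n)
  value-multiplicity n {j ∷ O} ((1≤j , j≤n) ∷ O⊆n) = begin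
    sumTo (λ i → (δ j i + multiplicity O i) * c i) n
      ≡⟨ sumTo-cong n (λ {i} _ _ → *-distribʳ-+ (c i) (δ j i) (multiplicity O i)) ⟩
    sumTo (λ i → δ j i * c i + multiplicity O i * c i) n
      ≡⟨ sumTo-+ (λ i → δ j i * c i) (λ i → multiplicity O i * c i) n ⟩
    sumTo (λ i → δ j i * c i) n + value c (multiplicity O) n
      ≡⟨ cong₂ _+_ (sumTo-δ* c n 1≤j j≤n) (value-multiplicity n O⊆n) ⟩
    c j + sum (map c O) ∎
    where open ≡-Reasoning

  value-toList : ∀ n α → sum (map c (toList n α)) ≡ value c α n
  value-toList zero    α = refl
  value-toList (suc n) α = begin
    sum (map c (toList n α ++ replicate (α (suc n)) (suc n)))
      ≡⟨ cong sum (map-++ c (toList n α) _) ⟩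
    sum (map c (toList n α) ++ map c (replicate (α (suc n)) (suc n)))
      ≡⟨ sum-++ (map c (toList n α)) _ ⟩
    sum (map c (toList n α)) + sum (map c (replicate (α (suc n)) (suc n)))
      ≡⟨ cong₂ _+_ (value-toList n α) (trans (cong sum (map-replicate c (α (suc n)) (suc n)))
                                             (sum-replicate (α (suc n)) (c (suc n)))) ⟩
    value c α (suc n) ∎
    where open ≡-Reasoning

size-multiplicity : ∀ n {O} → Indices n O → size n (multiplicity O) ≡ length O
size-multiplicity n {[]}    []                   = sumTo-zero n
size-multiplicity n {j ∷ O} ((1≤j , j≤n) ∷ O⊆n) =
  trans (sumTo-+ (δ j) (multiplicity O) n)
        (cong₂ _+_ (trans (sumTo-cong n λ {i} _ _ → sym (*-identityʳ (δ j i)))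
                          (sumTo-δ* (λ _ → 1) n 1≤j j≤n))
                   (size-multiplicity n O⊆n))

length-toList : ∀ n α → length (toList n α) ≡ size n α
length-toList zero    α = refl
length-toList (suc n) α =
  trans (length-++ (toList n α)) (cong₂ _+_ (length-toList n α) (length-replicate (α (suc n))))

Indices-weaken : ∀ {k n O} → k ≤ n → Indices k O → Indices n O
Indices-weaken k≤n = All.map λ (1≤i , i≤k) → 1≤i , ≤-trans i≤k k≤n

toList-indices : ∀ n α → Indices n (toList n α)
toList-indices zero    α = []
toList-indices (suc n) α =
  ++⁺ (Indices-weaken (n≤1+n n) (toList-indices n α)) (replicate⁺ (α (suc n)) (s≤s z≤n , ≤-refl))

divMod-unique : ∀ {v q d} .{{_ : NonZero d}} → v < d → (v + q * d) / d ≡ q × (v + q * d) % d ≡ v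
divMod-unique {v} {q} {d} v<d =
  trans (+-distrib-/-∣ʳ v (divides q refl)) (cong₂ _+_ (m<n⇒m/n≡0 v<d) (m*n/n≡m q d)) ,
  trans ([m+kn]%n≡m%n v q d) (m<n⇒m%n≡m v<d)

∸-exchange : ∀ a b {x} → a + b ≤ x → x ∸ b ≡ a + (x ∸ a ∸ b)
∸-exchange a b {x} a+b≤x = begin
  x ∸ b                       ≡⟨ cong (_∸ b) (sym (m+[n∸m]≡n a+b≤x)) ⟩
  (a + b) + (x ∸ (a + b)) ∸ b ≡⟨ cong (_∸ b) (xy∙z≈xz∙y a b (x ∸ (a + b))) ⟩
  (a + (x ∸ (a + b))) + b ∸ b ≡⟨ m+n∸n≡m _ b ⟩
  a + (x ∸ (a + b))           ≡⟨ cong (a +_) (sym (∸-+-assoc x a b)) ⟩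
  a + (x ∸ a ∸ b)             ∎
  where open ≡-Reasoning

module Greedy (c : ℕ → ℕ) where

  restrict : ∀ {k n} → k ≤ n → IsCoinSystem n c → IsCoinSystem k c
  restrict k≤n (c₁ , inc) = c₁ , λ i 1≤i i<k → inc i 1≤i (<-≤-trans i<k k≤n)

  module _ {n} (sys : IsCoinSystem n c) where

    coin-< : ∀ {i j} → 1 ≤ i → i < j → j ≤ n → c i < c j
    coin-< {i} {suc j} 1≤i (s≤s i≤j) j<n with m≤n⇒m<n∨m≡n i≤j
    ... | inj₁ i<j  = <-trans (coin-< 1≤i i<j (<⇒≤ j<n)) (proj₂ sys j (≤-trans 1≤i i≤j) j<n)
    ... | inj₂ refl = proj₂ sys i 1≤i j<n

    coin-≤ : ∀ {i j} → 1 ≤ i → i ≤ j → j ≤ n → c i ≤ c j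
    coin-≤ 1≤i i≤j j≤n with m≤n⇒m<n∨m≡n i≤j
    ... | inj₁ i<j  = <⇒≤ (coin-< 1≤i i<j j≤n)
    ... | inj₂ refl = ≤-refl

    coin-pos : ∀ {i} → 1 ≤ i → i ≤ n → 1 ≤ c i
    coin-pos {i} 1≤i i≤n = subst (_≤ c i) (proj₁ sys) (coin-≤ ≤-refl 1≤i i≤n)

    coin-<⁻¹ : ∀ {i j} → 1 ≤ j → i ≤ n → c i < c j → i < j
    coin-<⁻¹ {i} {j} 1≤j i≤n ci<cj with i <? j
    ... | yes i<j = i<j
    ... | no  i≮j = ⊥-elim (<⇒≱ ci<cj (coin-≤ 1≤j (≮⇒≥ i≮j) i≤n))

  top-pos : ∀ {n} → IsCoinSystem (suc n) c → 1 ≤ c (suc n)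
  top-pos sys = coin-pos sys (s≤s z≤n) ≤-refl

  -- c⁺ k agrees with c k on coins; it is written as a successor so that
  -- division by it finds its NonZero instance.
  c⁺ : ℕ → ℕ
  c⁺ k = suc (c k ∸ 1)

  c⁺≡c : ∀ {k} → 1 ≤ c k → c⁺ k ≡ c k
  c⁺≡c 1≤ck = trans (+-comm 1 _) (m∸n+n≡m 1≤ck)

  grd : ℕ → ℕ → ℕ
  grd zero    x = 0
  grd (suc n) x = x / c⁺ (suc n) + grd n (x % c⁺ (suc n))

  grdRep : ℕ → ℕ → ℕ → ℕ
  grdRep zero    x i = 0
  grdRep (suc n) x i with i ≟ suc n
  ... | yes _ = x / c⁺ (suc n)
  ... | no  _ = grdRep n (x % c⁺ (suc n)) i

  grd-zero : ∀ n → grd n 0 ≡ 0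
  grd-zero zero    = refl
  grd-zero (suc n) = grd-zero n

  grd-≥ : ∀ {n x} → IsCoinSystem (suc n) c → c (suc n) ≤ x →
          grd (suc n) x ≡ suc (grd (suc n) (x ∸ c (suc n)))
  grd-≥ {n} {x} sys cN≤x = begin
    x / C + grd n (x % C)
      ≡⟨ cong₂ _+_ (m/n≡1+[m∸n]/n C≤x) (cong (grd n) (sym (m≤n⇒[n∸m]%m≡n%m C≤x))) ⟩
    suc (grd (suc n) (x ∸ C))
      ≡⟨ cong (λ z → suc (grd (suc n) (x ∸ z))) C≡c ⟩
    suc (grd (suc n) (x ∸ c (suc n))) ∎
    where
    open ≡-Reasoning
    C = c⁺ (suc n)
    C≡c = c⁺≡c (top-pos sys)
    C≤x = subst (_≤ x) (sym C≡c) cN≤x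

  grd-< : ∀ {n x} → IsCoinSystem (suc n) c → x < c (suc n) → grd (suc n) x ≡ grd n x
  grd-< {n} {x} sys x<cN = cong₂ _+_ (m<n⇒m/n≡0 x<C) (cong (grd n) (m<n⇒m%n≡m x<C))
    where x<C = subst (x <_) (sym (c⁺≡c (top-pos sys))) x<cN

  grdRep-top : ∀ n x → grdRep (suc n) x (suc n) ≡ x / c⁺ (suc n)
  grdRep-top n x with suc n ≟ suc n
  ... | yes _   = refl
  ... | no  n≢n = ⊥-elim (n≢n refl)

  grdRep-below : ∀ {n i} x → i ≤ n → grdRep (suc n) x i ≡ grdRep n (x % c⁺ (suc n)) i
  grdRep-below {n} {i} x i≤n with i ≟ suc n
  ... | yes refl = ⊥-elim (1+n≰n i≤n)
  ... | no  _    = refl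

  value-grdRep-below : ∀ n {k} x → k ≤ n →
                       value c (grdRep (suc n) x) k ≡ value c (grdRep n (x % c⁺ (suc n))) k
  value-grdRep-below n x k≤n = sumTo-cong _ λ {i} _ i≤k → cong (_* c i) (grdRep-below x (≤-trans i≤k k≤n))

  grdRep-value : ∀ {n} → IsCoinSystem (suc n) c → ∀ x → value c (grdRep (suc n) x) (suc n) ≡ x
  grdRep-value {zero} (c₁ , _) x rewrite grdRep-top 0 x | c₁ = trans (*-identityʳ (x / 1)) (n/1≡n x)
  grdRep-value {suc n} sys x = begin
    value c (grdRep (suc (suc n)) x) (suc n) + grdRep (suc (suc n)) x (suc (suc n)) * c (suc (suc n))
      ≡⟨ cong₂ _+_ (trans (value-grdRep-below (suc n) x ≤-refl) (grdRep-value (restrict (n≤1+n _) sys) _))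
                   (cong₂ _*_ (grdRep-top (suc n) x) (sym (c⁺≡c (top-pos sys)))) ⟩
    x % C + x / C * C
      ≡⟨ sym (m≡m%n+[m/n]*n x C) ⟩
    x ∎
    where
    open ≡-Reasoning
    C = c⁺ (suc (suc n))

  grdRep-greedy : ∀ {n} → IsCoinSystem (suc n) c → ∀ x i → 2 ≤ i → i ≤ suc n →
                  value c (grdRep (suc n) x) (i ∸ 1) < c i
  grdRep-greedy {zero}  sys x i 2≤i i≤1 = ⊥-elim (1+n≰n (≤-trans 2≤i i≤1))
  grdRep-greedy {suc n} sys x i 2≤i i≤N with m≤n⇒m<n∨m≡n i≤N
  ... | inj₂ refl = begin-strict
    value c (grdRep (suc (suc n)) x) (suc n)   ≡⟨ value-grdRep-below (suc n) x ≤-refl ⟩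
    value c (grdRep (suc n) (x % C)) (suc n)   ≡⟨ grdRep-value (restrict (n≤1+n _) sys) _ ⟩
    x % C                                      <⟨ m%n<n x C ⟩
    C                                          ≡⟨ c⁺≡c (top-pos sys) ⟩
    c (suc (suc n))                            ∎
    where
    open ≤-Reasoning
    C = c⁺ (suc (suc n))
  ... | inj₁ (s≤s i≤1+n) =
    subst (_< c i) (sym (value-grdRep-below (suc n) x (≤-trans (m∸n≤m i 1) i≤1+n)))
          (grdRep-greedy (restrict (n≤1+n _) sys) _ i 2≤i i≤1+n)

  size-grdRep : ∀ n x → size n (grdRep n x) ≡ grd n x
  size-grdRep zero    x = refl
  size-grdRep (suc n) x =
    trans (cong₂ _+_ (trans (sumTo-cong n λ _ i≤n → grdRep-below x i≤n) (size-grdRep n _)) (grdRep-top n x))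
          (+-comm (grd n (x % c⁺ (suc n))) (x / c⁺ (suc n)))

  greedy-size : ∀ {n g x} → IsCoinSystem (suc n) c → IsGreedy (suc n) c g x → size (suc n) g ≡ grd (suc n) x
  greedy-size {zero} {g} {x} (c₁ , _) (g-value , _) = begin
    g 1                ≡⟨ sym (*-identityʳ (g 1)) ⟩
    g 1 * 1            ≡⟨ cong (g 1 *_) (sym c₁) ⟩
    g 1 * c 1          ≡⟨ g-value ⟩
    x                  ≡⟨ sym (n/1≡n x) ⟩
    x / 1              ≡⟨ cong (λ z → x / suc (z ∸ 1)) (sym c₁) ⟩
    x / c⁺ 1           ≡⟨ sym (+-identityʳ _) ⟩
    grd 1 x            ∎
    where open ≡-Reasoning
  greedy-size {suc n} {g} {x} sys (g-value , g-greedy) = begin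
    size (suc n) g + g N
      ≡⟨ cong₂ _+_ (greedy-size (restrict (n≤1+n _) sys) (refl , λ i 2≤i i≤ → g-greedy i 2≤i (m≤n⇒m≤1+n i≤)))
                   (sym x/C≡gN) ⟩
    grd (suc n) V + x / C   ≡⟨ +-comm (grd (suc n) V) (x / C) ⟩
    x / C + grd (suc n) V   ≡⟨ cong (λ z → x / C + grd (suc n) z) (sym x%C≡V) ⟩
    grd N x                 ∎
    where
    open ≡-Reasoning
    N = suc (suc n)
    C = c⁺ N
    V = value c g (suc n)
    C≡c = c⁺≡c (top-pos sys)
    x≡ : x ≡ V + g N * C
    x≡ = trans (sym g-value) (cong (λ z → V + g N * z) (sym C≡c))
    V<C : V < C
    V<C = subst (V <_) (sym C≡c) (g-greedy N (s≤s (s≤s z≤n)) ≤-refl)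
    x/C≡gN : x / C ≡ g N
    x/C≡gN = trans (cong (_/ C) x≡) (proj₁ (divMod-unique {q = g N} V<C))
    x%C≡V : x % C ≡ V
    x%C≡V = trans (cong (_% C) x≡) (proj₂ (divMod-unique {q = g N} V<C))

  -- Representations are taken as lists of coin indices; multiplicity and toList convert.
  Optimal : ℕ → ℕ → Set
  Optimal n x = ∀ {O} → Indices n O → sum (map c O) ≡ x → grd n x ≤ length O

  greedyList : ∀ {n} → IsCoinSystem (suc n) c → ∀ x →
               ∃[ O ] Indices (suc n) O × sum (map c O) ≡ x × length O ≡ grd (suc n) x
  greedyList {n} sys x =
    toList (suc n) α , toList-indices (suc n) α ,
    trans (value-toList c (suc n) α) (grdRep-value sys x) ,
    trans (length-toList (suc n) α) (size-grdRep (suc n) x)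
    where α = grdRep (suc n) x

  counterexample-from-list : ∀ {n x O} → IsCoinSystem (suc n) c → Indices (suc n) O → sum (map c O) ≡ x →
                             length O < grd (suc n) x → Counterexample (suc n) c x
  counterexample-from-list {n} {x} {O} sys O⊆ sumO len< =
    grdRep (suc n) x , multiplicity O , (grdRep-value sys x , grdRep-greedy sys x) ,
    trans (value-multiplicity c (suc n) O⊆) sumO ,
    subst₂ _<_ (sym (size-multiplicity (suc n) O⊆)) (sym (size-grdRep (suc n) x)) len<

  ¬counterexample⇒optimal : ∀ {n x} → IsCoinSystem (suc n) c → ¬ Counterexample (suc n) c x → Optimal (suc n) x
  ¬counterexample⇒optimal {n} {x} sys ¬cx {O} O⊆ sumO with grd (suc n) x ≤? length O
  ... | yes grd≤ = grd≤
  ... | no  grd≰ = ⊥-elim (¬cx (counterexample-from-list sys O⊆ sumO (≰⇒> grd≰)))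

  counterexample⇒¬optimal : ∀ {n x} → IsCoinSystem (suc n) c → Counterexample (suc n) c x → ¬ Optimal (suc n) x
  counterexample⇒¬optimal {n} {x} sys (g , r , g-greedy , r-rep , r<g) opt = <⇒≱ r<g (begin
    size (suc n) g              ≡⟨ greedy-size sys g-greedy ⟩
    grd (suc n) x               ≤⟨ opt (toList-indices (suc n) r) (trans (value-toList c (suc n) r) r-rep) ⟩
    length (toList (suc n) r)   ≡⟨ length-toList (suc n) r ⟩
    size (suc n) r              ∎)
    where open ≤-Reasoning

  optimal-+ : ∀ {n x y} → IsCoinSystem (suc n) c → Optimal (suc n) (x + y) →
              grd (suc n) (x + y) ≤ grd (suc n) x + grd (suc n) y
  optimal-+ {n} {x} {y} sys opt with greedyList sys x | greedyList sys y
  ... | O₁ , O₁⊆ , sum₁ , len₁ | O₂ , O₂⊆ , sum₂ , len₂ =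
    subst (grd (suc n) (x + y) ≤_) (trans (length-++ O₁) (cong₂ _+_ len₁ len₂))
          (opt (++⁺ O₁⊆ O₂⊆) (begin-equality
            sum (map c (O₁ ++ O₂))           ≡⟨ cong sum (map-++ c O₁ O₂) ⟩
            sum (map c O₁ ++ map c O₂)       ≡⟨ sum-++ (map c O₁) (map c O₂) ⟩
            sum (map c O₁) + sum (map c O₂)  ≡⟨ cong₂ _+_ sum₁ sum₂ ⟩
            x + y                            ∎))
    where open ≤-Reasoning

  optimal-coin+ : ∀ {n i x} → IsCoinSystem (suc n) c → 1 ≤ i → i ≤ suc n → Optimal (suc n) (c i + x) →
                  grd (suc n) (c i + x) ≤ suc (grd (suc n) x)
  optimal-coin+ {n} {i} {x} sys 1≤i i≤N opt with greedyList sys x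
  ... | O , O⊆ , sumO , lenO =
    subst (grd (suc n) (c i + x) ≤_) (cong suc lenO) (opt ((1≤i , i≤N) ∷ O⊆) (cong (c i +_) sumO))

  optimal-restrict : ∀ {n x} → IsCoinSystem (suc n) c → x < c (suc n) → Optimal (suc n) x → Optimal n x
  optimal-restrict sys x<cN opt O⊆ sumO =
    subst (_≤ _) (grd-< sys x<cN) (opt (Indices-weaken (n≤1+n _) O⊆) sumO)

  optimal-step : ∀ {n x} → IsCoinSystem (suc n) c → (∀ {y} → y < x → Optimal (suc n) y) →
                 (∀ {i} → 1 ≤ i → i ≤ suc n → c i ≤ x → grd (suc n) x ≤ suc (grd (suc n) (x ∸ c i))) →
                 Optimal (suc n) x
  optimal-step {n} sys opt< step {[]} [] sum≡x =
    subst (λ z → grd (suc n) z ≤ 0) sum≡x (≤-reflexive (grd-zero (suc n)))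
  optimal-step {n} {x} sys opt< step {i ∷ O} ((1≤i , i≤N) ∷ O⊆) sum≡x =
    ≤-trans (step 1≤i i≤N ci≤x) (s≤s (opt< (∸-monoʳ-< (coin-pos sys 1≤i i≤N) ci≤x) O⊆ sumO))
    where
    ci≤x : c i ≤ x
    ci≤x = subst (c i ≤_) sum≡x (m≤m+n (c i) _)
    sumO : sum (map c O) ≡ x ∸ c i
    sumO = trans (sym (m+n∸m≡n (c i) _)) (cong (_∸ c i) sum≡x)

  grd-exchange : ∀ {n i x} → IsCoinSystem (suc n) c → 1 ≤ i → i ≤ suc n → c i + c (suc n) ≤ x →
                 Optimal (suc n) (x ∸ c (suc n)) → grd (suc n) x ≤ suc (grd (suc n) (x ∸ c i))
  grd-exchange {n} {i} {x} sys 1≤i i≤N ci+cN≤x opt = begin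
    grd N x                              ≡⟨ grd-≥ sys (m+n≤o⇒n≤o (c i) ci+cN≤x) ⟩
    suc (grd N (x ∸ c N))                ≡⟨ cong (λ z → suc (grd N z)) split ⟩
    suc (grd N (c i + (x ∸ c i ∸ c N)))  ≤⟨ s≤s (optimal-coin+ sys 1≤i i≤N (subst (Optimal N) split opt)) ⟩
    suc (suc (grd N (x ∸ c i ∸ c N)))    ≡⟨ cong suc (grd-≥ sys cN≤x∸ci) ⟨
    suc (grd N (x ∸ c i))                ∎
    where
    open ≤-Reasoning
    N = suc n
    split : x ∸ c N ≡ c i + (x ∸ c i ∸ c N)
    split = ∸-exchange (c i) (c N) ci+cN≤x
    cN≤x∸ci : c N ≤ x ∸ c i
    cN≤x∸ci = m+n≤o⇒m≤o∸n (c N) (subst (_≤ x) (+-comm (c i) (c N)) ci+cN≤x)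

  optimal-from-double-top : ∀ {n} → IsCoinSystem (suc n) c →
                            (∀ {x} → x < c (suc n) + c (suc n) → Optimal (suc n) x) → ∀ x → Optimal (suc n) x
  optimal-from-double-top {n} sys opt-below = <-rec (Optimal N) step
    where
    N = suc n
    step : ∀ x → (∀ {y} → y < x → Optimal N y) → Optimal N x
    step x opt< with x <? c N + c N
    ... | yes x<2cN = opt-below x<2cN
    ... | no  x≮2cN = optimal-step sys opt< λ 1≤i i≤N _ →
      grd-exchange sys 1≤i i≤N (≤-trans (+-monoˡ-≤ (c N) (coin-≤ sys 1≤i i≤N ≤-refl)) 2cN≤x)
                   (opt< (∸-monoʳ-< (top-pos sys) (m+n≤o⇒m≤o (c N) 2cN≤x)))
      where 2cN≤x = ≮⇒≥ x≮2cN

  record TopCoin (n x : ℕ) : Set where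
    field
      top       : ℕ
      rest      : ℕ
      1≤top     : 1 ≤ top
      top≤n     : top ≤ n
      split     : x ≡ c top + rest
      maximal   : ∀ {i} → i ≤ n → c i ≤ x → i ≤ top
      grd-split : grd n x ≡ suc (grd n rest)

  topCoin : ∀ {n x} → IsCoinSystem (suc n) c → 1 ≤ x → TopCoin (suc n) x
  topCoin {n} {x} sys 1≤x with c (suc n) ≤? x
  ... | yes cN≤x = record
    { top = suc n ; rest = x ∸ c (suc n) ; 1≤top = s≤s z≤n ; top≤n = ≤-refl
    ; split = sym (m+[n∸m]≡n cN≤x) ; maximal = λ i≤N _ → i≤N ; grd-split = grd-≥ sys cN≤x }
  topCoin {zero}  {x} sys 1≤x | no cN≰x = ⊥-elim (cN≰x (subst (_≤ x) (sym (proj₁ sys)) 1≤x))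
  topCoin {suc n} {x} sys 1≤x | no cN≰x = record
    { top = top ; rest = rest ; 1≤top = 1≤top ; top≤n = m≤n⇒m≤1+n top≤n ; split = split
    ; maximal = maximal′ ; grd-split = grd-split′ }
    where
    open TopCoin (topCoin (restrict (n≤1+n _) sys) 1≤x)
    x<cN = ≰⇒> cN≰x
    maximal′ : ∀ {i} → i ≤ suc (suc n) → c i ≤ x → i ≤ top
    maximal′ i≤N ci≤x with m≤n⇒m<n∨m≡n i≤N
    ... | inj₁ (s≤s i≤1+n) = maximal i≤1+n ci≤x
    ... | inj₂ refl        = ⊥-elim (cN≰x ci≤x)
    grd-split′ : grd (suc (suc n)) x ≡ suc (grd (suc (suc n)) rest)
    grd-split′ = trans (grd-< sys x<cN) (trans grd-split (cong suc (sym (grd-< sys rest<cN))))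
      where rest<cN = ≤-<-trans (subst (rest ≤_) (sym split) (m≤n+m rest _)) x<cN

  grd-positive : ∀ {n x} → IsCoinSystem (suc n) c → 1 ≤ x → 1 ≤ grd (suc n) x
  grd-positive sys 1≤x = subst (1 ≤_) (sym (TopCoin.grd-split (topCoin sys 1≤x))) (s≤s z≤n)

  grd≤1⇒coin : ∀ {n e} → IsCoinSystem (suc n) c → 1 ≤ e → grd (suc n) e ≤ 1 →
               ∃[ k ] (1 ≤ k × k ≤ suc n) × c k ≡ e
  grd≤1⇒coin sys 1≤e grd≤1 =
    top , (1≤top , top≤n) , trans (sym (+-identityʳ _)) (trans (cong (c top +_) (sym rest≡0)) (sym split))
    where
    open TopCoin (topCoin sys 1≤e)
    rest≡0 : rest ≡ 0
    rest≡0 with 1 ≤? rest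
    ... | no  1≰rest = n<1⇒n≡0 (≰⇒> 1≰rest)
    ... | yes 1≤rest =
      ⊥-elim (1+n≰n (≤-trans (s≤s (grd-positive sys 1≤rest)) (subst (_≤ 1) grd-split grd≤1)))

-- m = suc k, so that the lemmas about ⟨ c 1 , … , c (suc n) ⟩ apply to ⟨ c 1 , … , c m ⟩ too.
module Extension (k : ℕ) (c : ℕ → ℕ) (sys : IsCoinSystem (suc (suc k)) c) where
  open Greedy c

  m N d : ℕ
  m = suc k
  N = suc m
  d = c N

  sysₘ : IsCoinSystem m c
  sysₘ = restrict (n≤1+n m) sys

  G : ℕ → ℕ
  G = grd N

  OptimalBelow : ℕ → Set
  OptimalBelow x = ∀ {v} → v < x → Optimal N v

  coin<d : ∀ {i} → 1 ≤ i → i ≤ m → c i < d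
  coin<d 1≤i i≤m = coin-< sys 1≤i (s≤s i≤m) ≤-refl

  coin<d⇒≤m : ∀ {i} → i ≤ N → c i < d → i ≤ m
  coin<d⇒≤m i≤N ci<d with m≤n⇒m<n∨m≡n i≤N
  ... | inj₁ (s≤s i≤m) = i≤m
  ... | inj₂ refl      = ⊥-elim (<-irrefl refl ci<d)

  d<cₘ+cₘ : OptimalBelow d → NonCanonical m c → d < c m + c m
  d<cₘ+cₘ opt-d (x , cx) with d <? c m + c m
  ... | yes d<2cₘ = d<2cₘ
  ... | no  d≮2cₘ = ⊥-elim (counterexample⇒¬optimal sysₘ cx (optimal-from-double-top sysₘ opt-below x))
    where
    opt-below : ∀ {v} → v < c m + c m → Optimal m v
    opt-below v<2cₘ = optimal-restrict sys v<d (opt-d v<d)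
      where v<d = <-≤-trans v<2cₘ (≮⇒≥ d≮2cₘ)

  PairExcessesAreCoins : Set
  PairExcessesAreCoins = ∀ {i j e} → 1 ≤ i → i ≤ m → 1 ≤ j → j ≤ m → c i + c j ≡ d + e → G e ≤ 1

  module _ (excess : PairExcessesAreCoins) where

    below-next-coin : ∀ {a w} → 1 ≤ a → a ≤ m → c a + w < c (suc a) → w + c m < d
    below-next-coin {a} {w} 1≤a a≤m cₐ+w<c[1+a] with m≤n⇒m<n∨m≡n a≤m
    ... | inj₂ refl = subst (_< d) (+-comm (c m) w) cₐ+w<c[1+a]
    ... | inj₁ a<m with c (suc a) + c m ≤? d
    ...   | yes c[1+a]+cₘ≤d =
      <-≤-trans (+-monoˡ-< (c m) (≤-<-trans (m≤n+m w (c a)) cₐ+w<c[1+a])) c[1+a]+cₘ≤d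
    ...   | no  c[1+a]+cₘ≰d = +-cancelˡ-< (c a) (w + c m) d (begin-strict
      c a + (w + c m)  ≡⟨ +-assoc (c a) w (c m) ⟨
      c a + w + c m    <⟨ +-monoˡ-< (c m) cₐ+w<c[1+a] ⟩
      c (suc a) + c m  ≡⟨ excess-def ⟩
      d + e            ≤⟨ +-monoʳ-≤ d e≤cₐ ⟩
      d + c a          ≡⟨ +-comm d (c a) ⟩
      c a + d          ∎)
      where
      open ≤-Reasoning
      d<c[1+a]+cₘ = ≰⇒> c[1+a]+cₘ≰d
      e = c (suc a) + c m ∸ d
      excess-def : c (suc a) + c m ≡ d + e
      excess-def = sym (m+[n∸m]≡n (<⇒≤ d<c[1+a]+cₘ))
      e<c[1+a] : e < c (suc a)
      e<c[1+a] = +-cancelˡ-< d e (c (suc a))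
        (subst₂ _<_ excess-def (+-comm (c (suc a)) d) (+-monoʳ-< (c (suc a)) (coin<d (s≤s z≤n) ≤-refl)))
      e≤cₐ : e ≤ c a
      e≤cₐ with grd≤1⇒coin sys (m<n⇒0<n∸m d<c[1+a]+cₘ)
                               (excess (s≤s z≤n) a<m (s≤s z≤n) ≤-refl excess-def)
      ... | i , (1≤i , i≤N) , cᵢ≡e = subst (_≤ c a) cᵢ≡e (coin-≤ sys 1≤i i≤a (m≤n⇒m≤1+n a≤m))
        where i≤a = ≤-pred (coin-<⁻¹ sys (s≤s z≤n) i≤N (subst (_< c (suc a)) (sym cᵢ≡e) e<c[1+a]))

    Exchange : ℕ → Set
    Exchange y = ∀ {a r} → 1 ≤ a → a ≤ m → y < d → y + c a ≡ d + r → OptimalBelow (d + r) → G r ≤ G y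

    module ExchangeStep (big : d < c m + c m) {y a r} (ih : ∀ {z} → z < y → Exchange z)
                        (1≤a : 1 ≤ a) (a≤m : a ≤ m) (y<d : y < d) (y+cₐ≡d+r : y + c a ≡ d + r)
                        (opt : OptimalBelow (d + r)) where

      a≤N = m≤n⇒m≤1+n a≤m

      d≤y+cₐ : d ≤ y + c a
      d≤y+cₐ = subst (d ≤_) (sym y+cₐ≡d+r) (m≤m+n d r)

      1≤y : 1 ≤ y
      1≤y = +-cancelʳ-< (c a) 0 y (<-≤-trans (coin<d 1≤a a≤m) d≤y+cₐ)

      open TopCoin (topCoin sys 1≤y)
        renaming (top to t; rest to y′; 1≤top to 1≤t; split to y≡cₜ+y′; grd-split to Gy≡)

      t≤m : t ≤ m
      t≤m = coin<d⇒≤m top≤n (≤-<-trans (subst (c t ≤_) (sym y≡cₜ+y′) (m≤m+n (c t) y′)) y<d)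

      y′<y : y′ < y
      y′<y = subst (y′ <_) (sym y≡cₜ+y′) (m<n+m y′ (coin-pos sys 1≤t top≤n))

      opt-r : Optimal N r
      opt-r = opt (m<n+m r (top-pos sys))

      pair-case : d ≤ c t + c a → G r ≤ G y
      pair-case d≤cₜ+cₐ = begin
        G r         ≡⟨ cong G r≡e+y′ ⟩
        G (e + y′)  ≤⟨ optimal-+ {x = e} {y′} sys (subst (Optimal N) r≡e+y′ opt-r) ⟩
        G e + G y′  ≤⟨ +-monoˡ-≤ (G y′) (excess 1≤t t≤m 1≤a a≤m cₜ+cₐ≡d+e) ⟩
        suc (G y′)  ≡⟨ Gy≡ ⟨
        G y         ∎
        where
        open ≤-Reasoning
        e = c t + c a ∸ d
        cₜ+cₐ≡d+e : c t + c a ≡ d + e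
        cₜ+cₐ≡d+e = sym (m+[n∸m]≡n d≤cₜ+cₐ)
        r≡e+y′ : r ≡ e + y′
        r≡e+y′ = +-cancelˡ-≡ d r (e + y′) (begin-equality
          d + r          ≡⟨ y+cₐ≡d+r ⟨
          y + c a        ≡⟨ cong (_+ c a) y≡cₜ+y′ ⟩
          c t + y′ + c a ≡⟨ xy∙z≈xz∙y (c t) y′ (c a) ⟩
          c t + c a + y′ ≡⟨ cong (_+ y′) cₜ+cₐ≡d+e ⟩
          d + e + y′     ≡⟨ +-assoc d e y′ ⟩
          d + (e + y′)   ∎)

      carry-case : d ≤ y′ + c a → G r ≤ G y
      carry-case d≤y′+cₐ = begin
        G r               ≡⟨ cong G r≡cₜ+r′ ⟩
        G (c t + r′)      ≤⟨ optimal-coin+ sys 1≤t top≤n (subst (Optimal N) r≡cₜ+r′ opt-r) ⟩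
        suc (G r′)        ≤⟨ s≤s (ih y′<y 1≤a a≤m (<-trans y′<y y<d) y′+cₐ≡d+r′ opt′) ⟩
        suc (G y′)        ≡⟨ Gy≡ ⟨
        G y               ∎
        where
        open ≤-Reasoning
        r′ = y′ + c a ∸ d
        y′+cₐ≡d+r′ : y′ + c a ≡ d + r′
        y′+cₐ≡d+r′ = sym (m+[n∸m]≡n d≤y′+cₐ)
        r≡cₜ+r′ : r ≡ c t + r′
        r≡cₜ+r′ = +-cancelˡ-≡ d r (c t + r′) (begin-equality
          d + r            ≡⟨ y+cₐ≡d+r ⟨
          y + c a          ≡⟨ cong (_+ c a) y≡cₜ+y′ ⟩
          c t + y′ + c a   ≡⟨ +-assoc (c t) y′ (c a) ⟩
          c t + (y′ + c a) ≡⟨ cong (c t +_) y′+cₐ≡d+r′ ⟩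
          c t + (d + r′)   ≡⟨ x∙yz≈y∙xz (c t) d r′ ⟩
          d + (c t + r′)   ∎)
        opt′ : OptimalBelow (d + r′)
        opt′ v<d+r′ = opt (<-≤-trans v<d+r′ (+-monoʳ-≤ d (subst (r′ ≤_) (sym r≡cₜ+r′) (m≤n+m r′ (c t)))))

      u = c a + y′

      u+cₜ≡d+r : u + c t ≡ d + r
      u+cₜ≡d+r = begin
        c a + y′ + c t  ≡⟨ xy∙z≈zy∙x (c a) y′ (c t) ⟩
        c t + y′ + c a  ≡⟨ cong (_+ c a) y≡cₜ+y′ ⟨
        y + c a         ≡⟨ y+cₐ≡d+r ⟩
        d + r           ∎
        where open ≡-Reasoning

      Gu≤Gy : G u ≤ G y
      Gu≤Gy = ≤-trans (optimal-coin+ sys 1≤a a≤N (opt u<d+r)) (≤-reflexive (sym Gy≡))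
        where u<d+r = subst (u <_) u+cₜ≡d+r (m<m+n u (coin-pos sys 1≤t top≤n))

      smaller-coin-case : c a < c t → u < d → G r ≤ G y
      smaller-coin-case cₐ<cₜ u<d = ≤-trans (ih u<y 1≤t t≤m u<d u+cₜ≡d+r opt) Gu≤Gy
        where u<y = subst (u <_) (sym y≡cₜ+y′) (+-monoˡ-< y′ cₐ<cₜ)

      1≤u : 1 ≤ u
      1≤u = ≤-trans (coin-pos sys 1≤a a≤N) (m≤m+n (c a) y′)

      module U = TopCoin (topCoin sys 1≤u)

      s = U.top
      u″ = U.rest

      a≤s : a ≤ s
      a≤s = U.maximal a≤N (m≤m+n (c a) y′)

      larger-top-case : a < s → u < d → G r ≤ G y
      larger-top-case a<s u<d = begin
        G r         ≤⟨ ih y″<y U.1≤top s≤m (<-trans y″<y y<d) y″+cₛ≡d+r opt ⟩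
        G y″        ≤⟨ optimal-coin+ sys 1≤t top≤n (opt (<-≤-trans (<-trans y″<y y<d) (m≤m+n d r))) ⟩
        suc (G u″)  ≡⟨ U.grd-split ⟨
        G u         ≤⟨ Gu≤Gy ⟩
        G y         ∎
        where
        open ≤-Reasoning
        s≤m : s ≤ m
        s≤m = coin<d⇒≤m U.top≤n (≤-<-trans (subst (c s ≤_) (sym U.split) (m≤m+n (c s) u″)) u<d)
        u″<y′ : u″ < y′
        u″<y′ = +-cancelˡ-< (c s) u″ y′
                  (subst (_< c s + y′) U.split (+-monoˡ-< y′ (coin-< sys 1≤a a<s U.top≤n)))
        y″ = c t + u″
        y″<y : y″ < y
        y″<y = subst (y″ <_) (sym y≡cₜ+y′) (+-monoʳ-< (c t) u″<y′)
        y″+cₛ≡d+r : y″ + c s ≡ d + r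
        y″+cₛ≡d+r = begin-equality
          c t + u″ + c s   ≡⟨ xy∙z≈x∙zy (c t) u″ (c s) ⟩
          c t + (c s + u″) ≡⟨ cong (c t +_) U.split ⟨
          c t + u          ≡⟨ +-comm (c t) u ⟩
          u + c t          ≡⟨ u+cₜ≡d+r ⟩
          d + r            ∎

      u<c[1+a] : a ≡ s → u < c (suc a)
      u<c[1+a] a≡s with c (suc a) ≤? u
      ... | no  c[1+a]≰u = ≰⇒> c[1+a]≰u
      ... | yes c[1+a]≤u =
        ⊥-elim (1+n≰n (subst (suc a ≤_) (sym a≡s) (U.maximal (s≤s a≤m) c[1+a]≤u)))

      d≤cₐ+cₘ : c t ≤ c a → c t + c a < d → d ≤ c a + c m
      d≤cₐ+cₘ cₜ≤cₐ cₜ+cₐ<d with d ≤? c a + c m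
      ... | yes d≤cₐ+cₘ = d≤cₐ+cₘ
      ... | no  d≰cₐ+cₘ = ⊥-elim (<-asym big (≤-<-trans 2cₘ≤cₜ+cₐ cₜ+cₐ<d))
        where
        cₘ<y : c m < y
        cₘ<y = +-cancelˡ-< (c a) (c m) y
                 (<-≤-trans (≰⇒> d≰cₐ+cₘ) (subst (d ≤_) (+-comm y (c a)) d≤y+cₐ))
        t≡m : t ≡ m
        t≡m = ≤-antisym t≤m (maximal (n≤1+n m) (<⇒≤ cₘ<y))
        2cₘ≤cₜ+cₐ : c m + c m ≤ c t + c a
        2cₘ≤cₜ+cₐ = +-mono-≤ (≤-reflexive (cong c (sym t≡m))) (subst (λ i → c i ≤ c a) t≡m cₜ≤cₐ)

      -- Here c a is also the greedy top coin of u.  Then r + c m < d, so greedy takes c m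
      -- first at r + c m, while r + c m = y + (c a + c m − d).
      final-case : c t ≤ c a → c t + c a < d → u < c (suc a) → G r ≤ G y
      final-case cₜ≤cₐ cₜ+cₐ<d u<c[1+a] = +-cancelʳ-≤ 1 (G r) (G y) (begin
        G r + 1      ≡⟨ +-comm (G r) 1 ⟩
        suc (G r)    ≡⟨ G[r+cₘ]≡ ⟨
        G (r + c m)  ≡⟨ cong G r+cₘ≡y+e ⟩
        G (y + e)    ≤⟨ optimal-+ {x = y} {e} sys (subst (Optimal N) r+cₘ≡y+e opt-r+cₘ) ⟩
        G y + G e    ≤⟨ +-monoʳ-≤ (G y) (excess 1≤a a≤m (s≤s z≤n) ≤-refl cₐ+cₘ≡d+e) ⟩
        G y + 1      ∎)
        where
        open ≤-Reasoning
        e = c a + c m ∸ d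
        cₐ+cₘ≡d+e : c a + c m ≡ d + e
        cₐ+cₘ≡d+e = sym (m+[n∸m]≡n (d≤cₐ+cₘ cₜ≤cₐ cₜ+cₐ<d))
        r+cₘ≡y+e : r + c m ≡ y + e
        r+cₘ≡y+e = +-cancelˡ-≡ d (r + c m) (y + e) (begin-equality
          d + (r + c m)   ≡⟨ +-assoc d r (c m) ⟨
          d + r + c m     ≡⟨ cong (_+ c m) y+cₐ≡d+r ⟨
          y + c a + c m   ≡⟨ +-assoc y (c a) (c m) ⟩
          y + (c a + c m) ≡⟨ cong (y +_) cₐ+cₘ≡d+e ⟩
          y + (d + e)     ≡⟨ x∙yz≈y∙xz y d e ⟩
          d + (y + e)     ∎)
        r<y′ : r < y′
        r<y′ = +-cancelˡ-< d r y′ (begin-strict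
          d + r           ≡⟨ y+cₐ≡d+r ⟨
          y + c a         ≡⟨ cong (_+ c a) y≡cₜ+y′ ⟩
          c t + y′ + c a  ≡⟨ xy∙z≈xz∙y (c t) y′ (c a) ⟩
          c t + c a + y′  <⟨ +-monoˡ-< y′ cₜ+cₐ<d ⟩
          d + y′          ∎)
        r+cₘ<d : r + c m < d
        r+cₘ<d = <-trans (+-monoˡ-< (c m) r<y′) (below-next-coin 1≤a a≤m u<c[1+a])
        opt-r+cₘ : Optimal N (r + c m)
        opt-r+cₘ = opt (<-≤-trans r+cₘ<d (m≤m+n d r))
        G[r+cₘ]≡ : G (r + c m) ≡ suc (G r)
        G[r+cₘ]≡ = begin-equality
          G (r + c m)                   ≡⟨ grd-< sys r+cₘ<d ⟩
          grd m (r + c m)               ≡⟨ grd-≥ sysₘ (m≤n+m (c m) r) ⟩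
          suc (grd m (r + c m ∸ c m))   ≡⟨ cong (λ z → suc (grd m z)) (m+n∸n≡m r (c m)) ⟩
          suc (grd m r)                 ≡⟨ cong suc (grd-< sys (≤-<-trans (m≤m+n r (c m)) r+cₘ<d)) ⟨
          suc (G r)                     ∎

      no-carry-case : c t + c a < d → u < d → G r ≤ G y
      no-carry-case cₜ+cₐ<d u<d with c a <? c t | m≤n⇒m<n∨m≡n a≤s
      ... | yes cₐ<cₜ | _         = smaller-coin-case cₐ<cₜ u<d
      ... | no  _     | inj₁ a<s  = larger-top-case a<s u<d
      ... | no  cₐ≮cₜ | inj₂ a≡s  = final-case (≮⇒≥ cₐ≮cₜ) cₜ+cₐ<d (u<c[1+a] a≡s)

      exchange-step : G r ≤ G y
      exchange-step with d ≤? c t + c a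
      ... | yes d≤cₜ+cₐ = pair-case d≤cₜ+cₐ
      ... | no  d≰cₜ+cₐ with d ≤? y′ + c a
      ...   | yes d≤y′+cₐ = carry-case d≤y′+cₐ
      ...   | no  d≰y′+cₐ = no-carry-case (≰⇒> d≰cₜ+cₐ) (subst (_< d) (+-comm y′ (c a)) (≰⇒> d≰y′+cₐ))

    exchange : d < c m + c m → ∀ y → Exchange y
    exchange big = <-rec Exchange λ y ih 1≤a a≤m y<d y+cₐ≡d+r opt →
      ExchangeStep.exchange-step big ih 1≤a a≤m y<d y+cₐ≡d+r opt

    optimal-everywhere : d < c m + c m → OptimalBelow d → ∀ x → Optimal N x
    optimal-everywhere big opt-d = <-rec (Optimal N) step
      where
      step : ∀ x → OptimalBelow x → Optimal N x
      step x opt< with x <? d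
      ... | yes x<d = opt-d x<d
      ... | no  x≮d = optimal-step sys opt< exchange-with
        where
        d≤x = ≮⇒≥ x≮d
        exchange-with : ∀ {i} → 1 ≤ i → i ≤ N → c i ≤ x → G x ≤ suc (G (x ∸ c i))
        exchange-with {i} 1≤i i≤N cᵢ≤x with c i + d ≤? x | i ≟ N
        ... | yes cᵢ+d≤x | _        = grd-exchange sys 1≤i i≤N cᵢ+d≤x (opt< (∸-monoʳ-< (top-pos sys) d≤x))
        ... | no  _      | yes refl = ≤-reflexive (grd-≥ sys d≤x)
        ... | no  cᵢ+d≰x | no  i≢N = begin
          G x               ≡⟨ grd-≥ sys d≤x ⟩
          suc (G (x ∸ d))   ≤⟨ s≤s (exchange big (x ∸ c i) 1≤i i≤m x∸cᵢ<d x∸cᵢ+cᵢ≡d+[x∸d] opt′) ⟩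
          suc (G (x ∸ c i)) ∎
          where
          open ≤-Reasoning
          i≤m = ≤-pred (≤∧≢⇒< i≤N i≢N)
          x∸cᵢ<d = m<n+o⇒m∸n<o x (c i) {{>-nonZero (top-pos sys)}} (≰⇒> cᵢ+d≰x)
          x∸cᵢ+cᵢ≡d+[x∸d] : x ∸ c i + c i ≡ d + (x ∸ d)
          x∸cᵢ+cᵢ≡d+[x∸d] = trans (m∸n+n≡m cᵢ≤x) (sym (m+[n∸m]≡n d≤x))
          opt′ : OptimalBelow (d + (x ∸ d))
          opt′ = subst OptimalBelow (sym (m+[n∸m]≡n d≤x)) opt<

  excesses-are-coins : (∀ {i j} → 2 ≤ i → i ≤ j → j ≤ m → d < c i + c j → G (c i + c j) ≤ 2) →
                       PairExcessesAreCoins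
  excesses-are-coins bounded {i} {j} {e} 1≤i i≤m 1≤j j≤m cᵢ+cⱼ≡d+e with e ≟ 0
  ... | yes refl = ≤-trans (≤-reflexive (grd-zero N)) z≤n
  ... | no  e≢0  = ≤-pred (begin
    suc (G e)                  ≡⟨ cong (λ z → suc (G z)) (m+n∸m≡n d e) ⟨
    suc (G (d + e ∸ d))        ≡⟨ grd-≥ sys (m≤m+n d e) ⟨
    G (d + e)                  ≡⟨ cong G cᵢ+cⱼ≡d+e ⟨
    G (c i + c j)              ≤⟨ bounded′ ⟩
    2                          ∎)
    where
    open ≤-Reasoning
    d<cᵢ+cⱼ : d < c i + c j
    d<cᵢ+cⱼ = subst (d <_) (sym cᵢ+cⱼ≡d+e) (m<m+n d (n≢0⇒n>0 e≢0))
    ordered : ∀ {i j} → 1 ≤ i → i ≤ j → j ≤ m → d < c i + c j → G (c i + c j) ≤ 2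
    ordered {j = j} 1≤i i≤j j≤m d<cᵢ+cⱼ with m≤n⇒m<n∨m≡n 1≤i
    ... | inj₁ 2≤i = bounded 2≤i i≤j j≤m d<cᵢ+cⱼ
    ... | inj₂ refl =
      ⊥-elim (<⇒≱ d<cᵢ+cⱼ (subst (λ z → z + c j ≤ d) (sym (proj₁ sys)) (coin<d (≤-trans 1≤i i≤j) j≤m)))
    bounded′ : G (c i + c j) ≤ 2
    bounded′ with ≤-total i j
    ... | inj₁ i≤j = ordered 1≤i i≤j j≤m d<cᵢ+cⱼ
    ... | inj₂ j≤i = subst (λ z → G z ≤ 2) (+-comm (c j) (c i))
                       (ordered 1≤j j≤i i≤m (subst (d <_) (+-comm (c i) (c j)) d<cᵢ+cⱼ))

  large-bad-pair? : ∀ i j → Dec (2 ≤ i × i ≤ j × d < c i + c j × 2 < G (c i + c j))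
  large-bad-pair? i j = 2 ≤? i ×-dec i ≤? j ×-dec d <? c i + c j ×-dec 2 <? G (c i + c j)

  large-pair-counterexample :
    OptimalBelow d → NonCanonical m c → NonCanonical N c →
    ∃[ i ] ∃[ j ] (2 ≤ i × i ≤ j × j ≤ m × d < c i + c j × Counterexample N c (c i + c j))
  large-pair-counterexample opt-d noncanonₘ (x , cx) with anyUpTo? (λ i → anyUpTo? (large-bad-pair? i) N) N
  ... | yes (i , _ , j , j<N , 2≤i , i≤j , d<cᵢ+cⱼ , 2<G) =
    i , j , 2≤i , i≤j , ≤-pred j<N , d<cᵢ+cⱼ ,
    counterexample-from-list sys pair (cong (c i +_) (+-identityʳ (c j))) 2<G
    where
    1≤i = ≤-trans (s≤s z≤n) 2≤i
    pair : Indices N (i ∷ j ∷ [])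
    pair = (1≤i , ≤-trans i≤j (<⇒≤ j<N)) ∷ (≤-trans 1≤i i≤j , <⇒≤ j<N) ∷ []
  ... | no  none =
    ⊥-elim (counterexample⇒¬optimal sys cx
      (optimal-everywhere (excesses-are-coins bounded) (d<cₘ+cₘ opt-d noncanonₘ) opt-d x))
    where
    bounded : ∀ {i j} → 2 ≤ i → i ≤ j → j ≤ m → d < c i + c j → G (c i + c j) ≤ 2
    bounded {i} {j} 2≤i i≤j j≤m d<cᵢ+cⱼ =
      ≮⇒≥ λ 2<G → none (i , s≤s (≤-trans i≤j j≤m) , j , s≤s j≤m , 2≤i , i≤j , d<cᵢ+cⱼ , 2<G)

theorem11 : (m : ℕ) → (c : ℕ → ℕ) → 3 ≤ m →
    c 1 ≡ 1 → 1 < c 2 → (∀ i → 2 ≤ i → i ≤ m → c i < c (suc i)) →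
    Tight 3 c → Tight m c → Tight (suc m) c →
    Canonical 3 c → NonCanonical m c → NonCanonical (suc m) c →
    ∃[ i ] ∃[ j ] (2 ≤ i × i ≤ j × j ≤ m ×
      c (suc m) < c i + c j × Counterexample (suc m) c (c i + c j))
theorem11 zero    c ()
theorem11 (suc k) c _ c₁ 1<c₂ inc _ _ tight _ noncanonₘ noncanonₘ₊₁ =
  large-pair-counterexample (λ {v} v<d → ¬counterexample⇒optimal sys (tight v v<d)) noncanonₘ noncanonₘ₊₁
  where
  sys : IsCoinSystem (suc (suc k)) c
  sys = c₁ , increasing
    where
    increasing : ∀ i → 1 ≤ i → i < suc (suc k) → c i < c (suc i)
    increasing i 1≤i i<N with m≤n⇒m<n∨m≡n 1≤i
    ... | inj₁ 2≤i  = inc i 2≤i (≤-pred i<N)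
    ... | inj₂ refl = subst (_< c 2) (sym c₁) 1<c₂
  open Greedy c using (¬counterexample⇒optimal)
  open Extension k c sys
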